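{- For every positive integer $m$, there is a formula $\varphi_m \in \mathrm{FO}^2_m[<]$ that separates $K_m$ and $L_m$.
   Context: For a positive integer $m$, let $\Sigma_m=\{\mathtt a_0,\dots,\mathtt a_{m-1}\}$. For positive integers $i,n$ define words over $\Sigma_m$ inductively: $u_{1,n}=\mathtt a_0$, $v_{1,n}=\varepsilon$ (empty word); $u_{2,n}=\mathtt a_0(\mathtt a_1\mathtt a_0)^{2n}$, $v_{2,n}=(\mathtt a_1\mathtt a_0)^{2n}$; $u_{2i+1,n}=(\mathtt a_0\mathtt a_1\cdots\mathtt a_{2i})^n\,u_{2i,n}$, $v_{2i+1,n}=(\mathtt a_0\cdots\mathtt a_{2i})^n\,v_{2i,n}$; $u_{2i+2,n}=u_{2i+1,n}\,(\mathtt a_{2i+1}\mathtt a_{2i}\cdots\mathtt a_0)^n$, $v_{2i+2,n}=v_{2i+1,n}\,(\mathtt a_{2i+1}\cdots\mathtt a_0)^n$. Let $K_m=\{u_{m,n}: n\ge1\}$ and $L_m=\{v_{m,n}:n\ge1\}$. Words are structures with universe $\{1,\dots,|w|\}$, linear order $<$ and unary predicates $Q_{\mathtt a}=\{i:w_i=\mathtt a\}$. $\mathrm{FO}^2_{m,n}[<]$ is the set of first-order formulas over this vocabulary using only variables $x,y$ (which may be requantified) with quantifier depth at most $n$ and such that any path in the parse tree has at most $m$ blocks of alternating quantifiers; $\mathrm{FO}^2_m[<]=\bigcup_{n\ge m}\mathrm{FO}^2_{m,n}[<]$. A formula $\varphi$ separates $K,L\subseteq\Sigma^\star$ if either all $w\in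 K$ satisfy $\varphi$ and no $w\in L$ does, or vice versa. -}

module Defs where

open import Data.Nat using (ℕ; zero; suc; _+_; _*_; _≤_; _<_; _⊔_)
open import Data.Bool using (Bool; true; false; if_then_else_)
open import Data.Fin using (Fin; toℕ)
open import Data.List using (List; []; _∷_; _++_; reverse; upTo)
open import Data.Maybe using (Maybe; just; nothing)
open import Data.Product using (Σ; _×_; _,_)
open import Data.Sum using (_⊎_)
open import Data.Unit using (⊤)
open import Data.Empty using (⊥)
open import Relation.Binary.PropositionalEquality using (_≡_)
open import Relation.Nullary using (¬_)

-- Words.  The letter a_j of Σ_m is represented by the natural number j
-- (all words below only use letters j < m when used with Σ_m).

rep : ℕ → List ℕ → List ℕ
rep zero    w = []
rep (suc n) w = w ++ rep n w

-- [0, 1, ..., k]  i.e. a_0 a_1 ... a_k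
up : ℕ → List ℕ
up k = upTo (suc k)

down : ℕ → List ℕ
down k = reverse (up k)

isEven : ℕ → Bool
isEven zero = true
isEven (suc zero) = false
isEven (suc (suc k)) = isEven k

-- u i n = u_{i,n}   (u 0 n is unused)
u : ℕ → ℕ → List ℕ
u zero n = []
u (suc zero) n = 0 ∷ []
u (suc (suc zero)) n = 0 ∷ rep (2 * n) (1 ∷ 0 ∷ [])
u (suc (suc (suc k))) n =
  if isEven k
  then rep n (up (suc (suc k))) ++ u (suc (suc k)) n      -- i = k+3 = 2j+1, 2j = k+2
  else u (suc (suc k)) n ++ rep n (down (suc (suc k)))    -- i = k+3 = 2j+2, 2j+1 = k+2

-- v i n = v_{i,n}   (v 0 n is unused)
v : ℕ → ℕ → List ℕ
v zero n = []
v (suc zero) n = []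
v (suc (suc zero)) n = rep (2 * n) (1 ∷ 0 ∷ [])
v (suc (suc (suc k))) n =
  if isEven k
  then rep n (up (suc (suc k))) ++ v (suc (suc k)) n
  else v (suc (suc k)) n ++ rep n (down (suc (suc k)))

-- Two-variable first-order logic FO²[<] over Σ_m, in negation normal form.

data Var : Set where
  vx vy : Var

data Fm (m : ℕ) : Set where
  tt ff   : Fm m
  Q       : Fin m → Var → Fm m
  nQ      : Fin m → Var → Fm m
  lt      : Var → Var → Fm m
  nlt     : Var → Var → Fm m
  eq      : Var → Var → Fm m
  neq     : Var → Var → Fm m
  _∧'_ _∨'_ : Fm m → Fm m → Fm m
  ex all  : Var → Fm m → Fm m

qd : ∀ {m} → Fm m → ℕ
qd (φ ∧' ψ) = qd φ ⊔ qd ψ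
qd (φ ∨' ψ) = qd φ ⊔ qd ψ
qd (ex z φ) = suc (qd φ)
qd (all z φ) = suc (qd φ)
qd _ = 0

-- maximal number of blocks of alternating quantifiers along a path of the
-- parse tree; the argument records the type of the last quantifier seen
-- (nothing = none yet, just true = ∃, just false = ∀).
blk : ∀ {m} → Maybe Bool → Fm m → ℕ
blk q (φ ∧' ψ) = blk q φ ⊔ blk q ψ
blk q (φ ∨' ψ) = blk q φ ⊔ blk q ψ
blk (just true)  (ex z φ) = blk (just true) φ
blk _            (ex z φ) = suc (blk (just true) φ)
blk (just false) (all z φ) = blk (just false) φ
blk _            (all z φ) = suc (blk (just false) φ)
blk q _ = 0

blocks : ∀ {m} → Fm m → ℕ
blocks = blk nothing

InFO2 : ∀ {m} → ℕ → ℕ → Fm m → Set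
InFO2 k n φ = qd φ ≤ n × blocks φ ≤ k

InFO2k : ∀ {m} → ℕ → Fm m → Set
InFO2k k φ = Σ ℕ (λ n → k ≤ n × InFO2 k n φ)

data Free {m} (z : Var) : Fm m → Set where
  fQ   : ∀ {a} → Free z (Q a z)
  fnQ  : ∀ {a} → Free z (nQ a z)
  flt₁ : ∀ {z'} → Free z (lt z z')
  flt₂ : ∀ {z'} → Free z (lt z' z)
  fnlt₁ : ∀ {z'} → Free z (nlt z z')
  fnlt₂ : ∀ {z'} → Free z (nlt z' z)
  feq₁ : ∀ {z'} → Free z (eq z z')
  feq₂ : ∀ {z'} → Free z (eq z' z)
  fneq₁ : ∀ {z'} → Free z (neq z z')
  fneq₂ : ∀ {z'} → Free z (neq z' z)
  f∧₁ : ∀ {φ ψ} → Free z φ → Free z (φ ∧' ψ)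
  f∧₂ : ∀ {φ ψ} → Free z ψ → Free z (φ ∧' ψ)
  f∨₁ : ∀ {φ ψ} → Free z φ → Free z (φ ∨' ψ)
  f∨₂ : ∀ {φ ψ} → Free z ψ → Free z (φ ∨' ψ)
  fex  : ∀ {z' φ} → ¬ (z ≡ z') → Free z φ → Free z (ex z' φ)
  fall : ∀ {z' φ} → ¬ (z ≡ z') → Free z φ → Free z (all z' φ)

Sentence : ∀ {m} → Fm m → Set
Sentence φ = (z : Var) → ¬ Free z φ

-- Semantics.  Positions of a word w are 0, ..., |w|-1 (order-isomorphic
-- to {1,...,|w|}); an assignment maps variables to naturals.

letterAt : List ℕ → ℕ → Maybe ℕ
letterAt [] i = nothing
letterAt (c ∷ w) zero = just c
letterAt (c ∷ w) (suc i) = letterAt w i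

len : List ℕ → ℕ
len [] = 0
len (_ ∷ w) = suc (len w)

update : (Var → ℕ) → Var → ℕ → (Var → ℕ)
update σ vx i vx = i
update σ vx i vy = σ vy
update σ vy i vx = σ vx
update σ vy i vy = i

Sat : ∀ {m} → List ℕ → (Var → ℕ) → Fm m → Set
Sat w σ tt = ⊤
Sat w σ ff = ⊥
Sat w σ (Q a z) = letterAt w (σ z) ≡ just (toℕ a)
Sat w σ (nQ a z) = ¬ (letterAt w (σ z) ≡ just (toℕ a))
Sat w σ (lt z z') = σ z < σ z'
Sat w σ (nlt z z') = ¬ (σ z < σ z')
Sat w σ (eq z z') = σ z ≡ σ z'
Sat w σ (neq z z') = ¬ (σ z ≡ σ z')
Sat w σ (φ ∧' ψ) = Sat w σ φ × Sat w σ ψ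
Sat w σ (φ ∨' ψ) = Sat w σ φ ⊎ Sat w σ ψ
Sat w σ (ex z φ) = Σ ℕ (λ i → i < len w × Sat w (update σ z i) φ)
Sat w σ (all z φ) = (i : ℕ) → i < len w → Sat w (update σ z i) φ

-- w ⊨ φ for a sentence φ (the initial assignment is irrelevant)
_⊨_ : ∀ {m} → List ℕ → Fm m → Set
w ⊨ φ = Sat w (λ _ → 0) φ

Separates : ∀ {m} → Fm m → (ℕ → List ℕ) → (ℕ → List ℕ) → Set
Separates φ f g =
  ((∀ n → 1 ≤ n → f n ⊨ φ) × (∀ n → 1 ≤ n → ¬ (g n ⊨ φ)))
  ⊎ ((∀ n → 1 ≤ n → ¬ (f n ⊨ φ)) × (∀ n → 1 ≤ n → g n ⊨ φ))

module Submission where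

-- The words u_{i+1,n}, v_{i+1,n} are obtained from u_{i,n}, v_{i,n} (which
-- only use letters below t = i) by adding a block around them:
--   appending  (a_t ⋯ a_0)^n, which begins with the letter a_t, or
--   prepending (a_0 ⋯ a_t)^n, which ends with the letter a_t.
-- In the first case u_{i,n} is exactly the part of u_{i+1,n} before the
-- first a_t, in the second it is the part after the last a_t (and likewise
-- for v).  So φ_1 = ∃x Q_{a_0}(x) separates K_1 from L_1, and φ_{i+1} is φ_i
-- relativised to that part.  Relativising a quantifier ∃z ψ to "z before
-- every a_t", i.e. ∀z'(¬Q_{a_t}(z') ∨ z < z'), adds one alternation block,
-- and dually for ∀; hence φ_m uses at most m blocks.

open import Defs
open import Data.Nat using (ℕ; zero; suc; _+_; _*_; _∸_; _≤_; _<_; _⊔_; z≤n; s≤s; _<?_)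
open import Data.Nat.Properties
open import Data.Nat.DivMod using (_mod_; m<n⇒m%n≡m)
open import Data.Bool using (true; false; if_then_else_)
open import Data.Fin using (Fin; toℕ)
open import Data.Fin.Properties using (toℕ-fromℕ<)
open import Data.List using (List; []; _∷_; _++_; _∷ʳ_; upTo; downFrom)
open import Data.List.Properties using (++-assoc; ++-identityʳ; upTo-∷ʳ; reverse-upTo; ∷ʳ-++)
open import Data.List.Relation.Unary.All as All using (All; []; _∷_)
open import Data.List.Relation.Unary.All.Properties using (++⁺; all-upTo; applyDownFrom⁺₁)
open import Data.Maybe using (just; nothing)
open import Data.Product using (Σ; _×_; _,_; proj₁; proj₂)
open import Data.Sum using (_⊎_; inj₁; inj₂)
open import Data.Empty using (⊥-elim)
open import Function using (_∘_; _∘₂_; id)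
open import Function.Bundles using (_⇔_; mk⇔; Equivalence)
open import Relation.Nullary using (¬_; yes; no)
open import Relation.Binary.PropositionalEquality
  using (_≡_; refl; sym; trans; cong; subst; subst₂; module ≡-Reasoning)

open Equivalence using (to; from)

len-middle : ∀ a (c : ℕ) b → len (a ++ c ∷ b) ≡ suc (len a + len b)
len-middle []      c b = refl
len-middle (x ∷ a) c b = cong suc (len-middle a c b)

letterAt-bound : ∀ w i {c} → letterAt w i ≡ just c → i < len w
letterAt-bound (x ∷ w) zero    _ = s≤s z≤n
letterAt-bound (x ∷ w) (suc i) e = s≤s (letterAt-bound w i e)

letterAt-++ˡ : ∀ a b i → i < len a → letterAt (a ++ b) i ≡ letterAt a i
letterAt-++ˡ (x ∷ a) b zero    _       = refl
letterAt-++ˡ (x ∷ a) b (suc i) (s≤s p) = letterAt-++ˡ a b i p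

letterAt-middle : ∀ a c b → letterAt (a ++ c ∷ b) (len a) ≡ just c
letterAt-middle []      c b = refl
letterAt-middle (x ∷ a) c b = letterAt-middle a c b

letterAt-after : ∀ a c b i → letterAt (a ++ c ∷ b) (suc (len a + i)) ≡ letterAt b i
letterAt-after []      c b i = refl
letterAt-after (x ∷ a) c b i = letterAt-after a c b i

letterAt-All : ∀ {P : ℕ → Set} {s} i {c} → All P s → letterAt s i ≡ just c → P c
letterAt-All zero    (p ∷ _)  refl = p
letterAt-All (suc i) (_ ∷ ps) e    = letterAt-All i ps e

Avoids : ℕ → List ℕ → Set
Avoids c s = ∀ i → ¬ letterAt s i ≡ just c

below⇒avoids : ∀ {c s} → All (_< c) s → Avoids c s
below⇒avoids bounded i e = <-irrefl refl (letterAt-All i bounded e)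

StartsWith : ℕ → List ℕ → Set
StartsWith c r = Σ (List ℕ) (λ r′ → r ≡ c ∷ r′)

EndsWith : ℕ → List ℕ → Set
EndsWith c p = Σ (List ℕ) (λ p′ → p ≡ p′ ∷ʳ c)

Shifted : ℕ → ℕ → ℕ → ℕ → Set
Shifted off l i k = i ≡ off + k × k < l

Inside : ℕ → ℕ → ℕ → Set
Inside off l i = Σ ℕ (Shifted off l i)

-- In holds exactly on the positions of the factor [off, off + l) of w and
-- Out exactly outside of it (constructively: the two halves of Out = ¬ In).
record Delimits (w : List ℕ) (off l : ℕ) (In Out : ℕ → Set) : Set where
  field
    In⇒inside     : ∀ i → i < len w → In i → Inside off l i
    inside⇒In     : ∀ k → k < l → In (off + k)
    inside⇒¬Out   : ∀ k → k < l → ¬ Out (off + k)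
    inside-or-Out : ∀ i → i < len w → Inside off l i ⊎ Out i

module _ {m : ℕ} where

  -- Quantifiers are guarded: ∃z ψ ↦ ∃z (G z ∧ ψ) and ∀z ψ ↦ ∀z (N z ∨ ψ);
  -- N is meant to be the negation of G.
  relativise : (Var → Fm m) → (Var → Fm m) → Fm m → Fm m
  relativise G N (φ ∧' ψ) = relativise G N φ ∧' relativise G N ψ
  relativise G N (φ ∨' ψ) = relativise G N φ ∨' relativise G N ψ
  relativise G N (ex z φ)  = ex z (G z ∧' relativise G N φ)
  relativise G N (all z φ) = all z (N z ∨' relativise G N φ)
  relativise G N tt         = tt
  relativise G N ff         = ff
  relativise G N (Q a z)    = Q a z
  relativise G N (nQ a z)   = nQ a z
  relativise G N (lt z z′)  = lt z z′
  relativise G N (nlt z z′) = nlt z z′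
  relativise G N (eq z z′)  = eq z z′
  relativise G N (neq z z′) = neq z z′

  OnlyFree : (Var → Fm m) → Set
  OnlyFree G = ∀ z z′ → Free z′ (G z) → z′ ≡ z

  module _ {G N : Var → Fm m} (G-only : OnlyFree G) (N-only : OnlyFree N) where

    relativise-free : ∀ {z} φ → Free z (relativise G N φ) → Free z φ
    relativise-free (φ ∧' ψ) (f∧₁ f) = f∧₁ (relativise-free φ f)
    relativise-free (φ ∧' ψ) (f∧₂ f) = f∧₂ (relativise-free ψ f)
    relativise-free (φ ∨' ψ) (f∨₁ f) = f∨₁ (relativise-free φ f)
    relativise-free (φ ∨' ψ) (f∨₂ f) = f∨₂ (relativise-free ψ f)
    relativise-free (ex z φ)  (fex z′≢z (f∧₁ g))  = ⊥-elim (z′≢z (G-only _ _ g))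
    relativise-free (ex z φ)  (fex z′≢z (f∧₂ f))  = fex z′≢z (relativise-free φ f)
    relativise-free (all z φ) (fall z′≢z (f∨₁ g)) = ⊥-elim (z′≢z (N-only _ _ g))
    relativise-free (all z φ) (fall z′≢z (f∨₂ f)) = fall z′≢z (relativise-free φ f)
    relativise-free (Q a z)    f = f
    relativise-free (nQ a z)   f = f
    relativise-free (lt z z′)  f = f
    relativise-free (nlt z z′) f = f
    relativise-free (eq z z′)  f = f
    relativise-free (neq z z′) f = f

    relativise-sentence : ∀ φ → Sentence φ → Sentence (relativise G N φ)
    relativise-sentence φ closed z = closed z ∘ relativise-free φ

  module _ {G N : Var → Fm m}
           (G-blk : ∀ z → blk (just true) (G z) ≤ 1)
           (N-blk : ∀ z → blk (just false) (N z) ≤ 1) where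

    private
      ⊔-lub-1 : ∀ {a b c} → a ≤ 1 → b ≤ suc c → a ⊔ b ≤ suc c
      ⊔-lub-1 a≤1 b≤ = ⊔-lub (≤-trans a≤1 (s≤s z≤n)) b≤

    relativise-blk : ∀ q φ → blk q (relativise G N φ) ≤ suc (blk q φ)
    relativise-blk q (φ ∧' ψ) = ⊔-mono-≤ (relativise-blk q φ) (relativise-blk q ψ)
    relativise-blk q (φ ∨' ψ) = ⊔-mono-≤ (relativise-blk q φ) (relativise-blk q ψ)
    relativise-blk (just true)  (ex z φ) = ⊔-lub-1 (G-blk z) (relativise-blk (just true) φ)
    relativise-blk (just false) (ex z φ) = s≤s (⊔-lub-1 (G-blk z) (relativise-blk (just true) φ))
    relativise-blk nothing      (ex z φ) = s≤s (⊔-lub-1 (G-blk z) (relativise-blk (just true) φ))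
    relativise-blk (just false) (all z φ) = ⊔-lub-1 (N-blk z) (relativise-blk (just false) φ)
    relativise-blk (just true)  (all z φ) = s≤s (⊔-lub-1 (N-blk z) (relativise-blk (just false) φ))
    relativise-blk nothing      (all z φ) = s≤s (⊔-lub-1 (N-blk z) (relativise-blk (just false) φ))
    relativise-blk q tt         = z≤n
    relativise-blk q ff         = z≤n
    relativise-blk q (Q a z)    = z≤n
    relativise-blk q (nQ a z)   = z≤n
    relativise-blk q (lt z z′)  = z≤n
    relativise-blk q (nlt z z′) = z≤n
    relativise-blk q (eq z z′)  = z≤n
    relativise-blk q (neq z z′) = z≤n

  Expresses : List ℕ → (Var → Fm m) → (ℕ → Set) → Set₁
  Expresses w G P = ∀ σ z i → Sat w (update σ z i) (G z) ≡ P i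

  -- Transfer principle: when s occurs in w at offset off and the guards
  -- delimit that occurrence, relativised formulas evaluated in w behave as
  -- the original formulas evaluated in s.
  module Transfer (w s : List ℕ) (off : ℕ)
      (letters : ∀ k → k < len s → letterAt w (off + k) ≡ letterAt s k)
      (fits : off + len s ≤ len w)
      {G N : Var → Fm m} {In Out : ℕ → Set}
      (G-expresses : Expresses w G In) (N-expresses : Expresses w N Out)
      (delimits : Delimits w off (len s) In Out) where

    open Delimits delimits

    Agree : (Var → ℕ) → (Var → ℕ) → Fm m → Set
    Agree σ σ′ φ = ∀ z → Free z φ → Shifted off (len s) (σ z) (σ′ z)

    agree-update : ∀ {φ σ σ′ i k} z → Shifted off (len s) i k →
      (∀ z′ → ¬ z′ ≡ z → Free z′ φ → Shifted off (len s) (σ z′) (σ′ z′)) →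
      Agree (update σ z i) (update σ′ z k) φ
    agree-update vx sh others vx _ = sh
    agree-update vx sh others vy f = others vy (λ ()) f
    agree-update vy sh others vx f = others vx (λ ()) f
    agree-update vy sh others vy _ = sh

    in-w : ∀ {k} → k < len s → off + k < len w
    in-w k<s = <-≤-trans (+-monoʳ-< off k<s) fits

    same-letter : ∀ {i k} → Shifted off (len s) i k → letterAt w i ≡ letterAt s k
    same-letter (refl , k<s) = letters _ k<s

    shift-< : ∀ {i j k l} → Shifted off (len s) i k → Shifted off (len s) j l → (i < j) ⇔ (k < l)
    shift-< (refl , _) (refl , _) = mk⇔ (+-cancelˡ-< off _ _) (+-monoʳ-< off)

    shift-≡ : ∀ {i j k l} → Shifted off (len s) i k → Shifted off (len s) j l → (i ≡ j) ⇔ (k ≡ l)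
    shift-≡ (refl , _) (refl , _) = mk⇔ (+-cancelˡ-≡ off _ _) (cong (off +_))

    G⇒In : ∀ σ z i → Sat w (update σ z i) (G z) → In i
    G⇒In σ z i = subst id (G-expresses σ z i)

    In⇒G : ∀ σ z i → In i → Sat w (update σ z i) (G z)
    In⇒G σ z i = subst id (sym (G-expresses σ z i))

    N⇒Out : ∀ σ z i → Sat w (update σ z i) (N z) → Out i
    N⇒Out σ z i = subst id (N-expresses σ z i)

    Out⇒N : ∀ σ z i → Out i → Sat w (update σ z i) (N z)
    Out⇒N σ z i = subst id (sym (N-expresses σ z i))

    restrict : ∀ φ σ σ′ → Agree σ σ′ φ → Sat w σ (relativise G N φ) → Sat s σ′ φ
    extend   : ∀ φ σ σ′ → Agree σ σ′ φ → Sat s σ′ φ → Sat w σ (relativise G N φ)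

    restrict tt σ σ′ ag p = p
    restrict ff σ σ′ ag p = p
    restrict (Q a z)    σ σ′ ag p   = trans (sym (same-letter (ag z fQ))) p
    restrict (nQ a z)   σ σ′ ag p e = p (trans (same-letter (ag z fnQ)) e)
    restrict (lt z z′)  σ σ′ ag p   = to (shift-< (ag z flt₁) (ag z′ flt₂)) p
    restrict (nlt z z′) σ σ′ ag p q = p (from (shift-< (ag z fnlt₁) (ag z′ fnlt₂)) q)
    restrict (eq z z′)  σ σ′ ag p   = to (shift-≡ (ag z feq₁) (ag z′ feq₂)) p
    restrict (neq z z′) σ σ′ ag p q = p (from (shift-≡ (ag z fneq₁) (ag z′ fneq₂)) q)
    restrict (φ ∧' ψ) σ σ′ ag (p , q) =
      restrict φ σ σ′ (λ z → ag z ∘ f∧₁) p , restrict ψ σ σ′ (λ z → ag z ∘ f∧₂) q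
    restrict (φ ∨' ψ) σ σ′ ag (inj₁ p) = inj₁ (restrict φ σ σ′ (λ z → ag z ∘ f∨₁) p)
    restrict (φ ∨' ψ) σ σ′ ag (inj₂ q) = inj₂ (restrict ψ σ σ′ (λ z → ag z ∘ f∨₂) q)
    restrict (ex z φ) σ σ′ ag (i , i<w , g , p) with In⇒inside i i<w (G⇒In σ z i g)
    ... | k , sh = k , proj₂ sh ,
      restrict φ (update σ z i) (update σ′ z k)
        (agree-update z sh (λ z′ z′≢z → ag z′ ∘ fex z′≢z)) p
    restrict (all z φ) σ σ′ ag p k k<s with p (off + k) (in-w k<s)
    ... | inj₁ n = ⊥-elim (inside⇒¬Out k k<s (N⇒Out σ z (off + k) n))
    ... | inj₂ q = restrict φ (update σ z (off + k)) (update σ′ z k)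
        (agree-update z (refl , k<s) (λ z′ z′≢z → ag z′ ∘ fall z′≢z)) q

    extend tt σ σ′ ag p = p
    extend ff σ σ′ ag p = p
    extend (Q a z)    σ σ′ ag p   = trans (same-letter (ag z fQ)) p
    extend (nQ a z)   σ σ′ ag p e = p (trans (sym (same-letter (ag z fnQ))) e)
    extend (lt z z′)  σ σ′ ag p   = from (shift-< (ag z flt₁) (ag z′ flt₂)) p
    extend (nlt z z′) σ σ′ ag p q = p (to (shift-< (ag z fnlt₁) (ag z′ fnlt₂)) q)
    extend (eq z z′)  σ σ′ ag p   = from (shift-≡ (ag z feq₁) (ag z′ feq₂)) p
    extend (neq z z′) σ σ′ ag p q = p (to (shift-≡ (ag z fneq₁) (ag z′ fneq₂)) q)
    extend (φ ∧' ψ) σ σ′ ag (p , q) =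
      extend φ σ σ′ (λ z → ag z ∘ f∧₁) p , extend ψ σ σ′ (λ z → ag z ∘ f∧₂) q
    extend (φ ∨' ψ) σ σ′ ag (inj₁ p) = inj₁ (extend φ σ σ′ (λ z → ag z ∘ f∨₁) p)
    extend (φ ∨' ψ) σ σ′ ag (inj₂ q) = inj₂ (extend ψ σ σ′ (λ z → ag z ∘ f∨₂) q)
    extend (ex z φ) σ σ′ ag (k , k<s , p) =
      off + k , in-w k<s , In⇒G σ z (off + k) (inside⇒In k k<s) ,
      extend φ (update σ z (off + k)) (update σ′ z k)
        (agree-update z (refl , k<s) (λ z′ z′≢z → ag z′ ∘ fex z′≢z)) p
    extend (all z φ) σ σ′ ag p i i<w with inside-or-Out i i<w
    ... | inj₁ (k , sh) = inj₂ (extend φ (update σ z i) (update σ′ z k)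
        (agree-update z sh (λ z′ z′≢z → ag z′ ∘ fall z′≢z)) (p k (proj₂ sh)))
    ... | inj₂ q = inj₁ (Out⇒N σ z i q)

    transfer : ∀ φ → Sentence φ → (w ⊨ relativise G N φ) ⇔ (s ⊨ φ)
    transfer φ closed = mk⇔ (restrict φ _ _ no-free) (extend φ _ _ no-free)
      where
      no-free : Agree (λ _ → 0) (λ _ → 0) φ
      no-free z f = ⊥-elim (closed z f)

other : Var → Var
other vx = vy
other vy = vx

module _ {m : ℕ} (a : Fin m) where

  beforeAll notBeforeAll : Var → Fm m
  beforeAll    z = all (other z) (nQ a (other z) ∨' lt z (other z))
  notBeforeAll z = ex (other z) (Q a (other z) ∧' nlt z (other z))

  afterAll notAfterAll : Var → Fm m
  afterAll    z = all (other z) (nQ a (other z) ∨' lt (other z) z)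
  notAfterAll z = ex (other z) (Q a (other z) ∧' nlt (other z) z)

  beforeAll-only : OnlyFree beforeAll
  beforeAll-only z _ (fall z′≢ (f∨₁ fnQ))  = ⊥-elim (z′≢ refl)
  beforeAll-only z _ (fall z′≢ (f∨₂ flt₁)) = refl
  beforeAll-only z _ (fall z′≢ (f∨₂ flt₂)) = ⊥-elim (z′≢ refl)

  notBeforeAll-only : OnlyFree notBeforeAll
  notBeforeAll-only z _ (fex z′≢ (f∧₁ fQ))    = ⊥-elim (z′≢ refl)
  notBeforeAll-only z _ (fex z′≢ (f∧₂ fnlt₁)) = refl
  notBeforeAll-only z _ (fex z′≢ (f∧₂ fnlt₂)) = ⊥-elim (z′≢ refl)

  afterAll-only : OnlyFree afterAll
  afterAll-only z _ (fall z′≢ (f∨₁ fnQ))  = ⊥-elim (z′≢ refl)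
  afterAll-only z _ (fall z′≢ (f∨₂ flt₁)) = ⊥-elim (z′≢ refl)
  afterAll-only z _ (fall z′≢ (f∨₂ flt₂)) = refl

  notAfterAll-only : OnlyFree notAfterAll
  notAfterAll-only z _ (fex z′≢ (f∧₁ fQ))    = ⊥-elim (z′≢ refl)
  notAfterAll-only z _ (fex z′≢ (f∧₂ fnlt₁)) = ⊥-elim (z′≢ refl)
  notAfterAll-only z _ (fex z′≢ (f∧₂ fnlt₂)) = refl

  relBefore relAfter : Fm m → Fm m
  relBefore = relativise beforeAll notBeforeAll
  relAfter  = relativise afterAll notAfterAll

  relBefore-sentence : ∀ φ → Sentence φ → Sentence (relBefore φ)
  relBefore-sentence = relativise-sentence beforeAll-only notBeforeAll-only

  relAfter-sentence : ∀ φ → Sentence φ → Sentence (relAfter φ)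
  relAfter-sentence = relativise-sentence afterAll-only notAfterAll-only

  relBefore-blocks : ∀ φ → blocks (relBefore φ) ≤ suc (blocks φ)
  relBefore-blocks = relativise-blk (λ _ → ≤-refl) (λ _ → ≤-refl) nothing

  relAfter-blocks : ∀ φ → blocks (relAfter φ) ≤ suc (blocks φ)
  relAfter-blocks = relativise-blk (λ _ → ≤-refl) (λ _ → ≤-refl) nothing

BeforeAll NotBeforeAll AfterAll NotAfterAll : List ℕ → ℕ → ℕ → Set
BeforeAll    w c i = ∀ j → j < len w → ¬ letterAt w j ≡ just c ⊎ i < j
NotBeforeAll w c i = Σ ℕ (λ j → j < len w × letterAt w j ≡ just c × ¬ i < j)
AfterAll     w c i = ∀ j → j < len w → ¬ letterAt w j ≡ just c ⊎ j < i
NotAfterAll  w c i = Σ ℕ (λ j → j < len w × letterAt w j ≡ just c × ¬ j < i)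

module _ {m : ℕ} (a : Fin m) (w : List ℕ) where

  beforeAll-expresses : Expresses w (beforeAll a) (BeforeAll w (toℕ a))
  beforeAll-expresses σ vx i = refl
  beforeAll-expresses σ vy i = refl

  notBeforeAll-expresses : Expresses w (notBeforeAll a) (NotBeforeAll w (toℕ a))
  notBeforeAll-expresses σ vx i = refl
  notBeforeAll-expresses σ vy i = refl

  afterAll-expresses : Expresses w (afterAll a) (AfterAll w (toℕ a))
  afterAll-expresses σ vx i = refl
  afterAll-expresses σ vy i = refl

  notAfterAll-expresses : Expresses w (notAfterAll a) (NotAfterAll w (toℕ a))
  notAfterAll-expresses σ vx i = refl
  notAfterAll-expresses σ vy i = refl

beforeAll-delimits : ∀ A c B → Avoids c A →
  Delimits (A ++ c ∷ B) 0 (len A) (BeforeAll (A ++ c ∷ B) c) (NotBeforeAll (A ++ c ∷ B) c)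
beforeAll-delimits A c B avoid = record
  { In⇒inside     = In⇒inside
  ; inside⇒In     = inside⇒In
  ; inside⇒¬Out   = λ { k k<A (j , _ , e , ¬k<j) → no-c-in-A j (≤-<-trans (≮⇒≥ ¬k<j) k<A) e }
  ; inside-or-Out = inside-or-Out
  }
  where
  w = A ++ c ∷ B
  c-at : letterAt w (len A) ≡ just c
  c-at = letterAt-middle A c B
  A<w : len A < len w
  A<w = letterAt-bound w (len A) c-at
  no-c-in-A : ∀ j → j < len A → ¬ letterAt w j ≡ just c
  no-c-in-A j j<A e = avoid j (trans (sym (letterAt-++ˡ A (c ∷ B) j j<A)) e)

  In⇒inside : ∀ i → i < len w → BeforeAll w c i → Inside 0 (len A) i
  In⇒inside i _ p with p (len A) A<w
  ... | inj₁ not-c = ⊥-elim (not-c c-at)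
  ... | inj₂ i<A   = i , refl , i<A

  inside⇒In : ∀ k → k < len A → BeforeAll w c k
  inside⇒In k k<A j _ with k <? j
  ... | yes k<j = inj₂ k<j
  ... | no ¬k<j = inj₁ (no-c-in-A j (≤-<-trans (≮⇒≥ ¬k<j) k<A))

  inside-or-Out : ∀ i → i < len w → Inside 0 (len A) i ⊎ NotBeforeAll w c i
  inside-or-Out i _ with i <? len A
  ... | yes i<A = inj₁ (i , refl , i<A)
  ... | no ¬i<A = inj₂ (len A , A<w , c-at , ¬i<A)

afterAll-delimits : ∀ A c B → Avoids c B →
  Delimits (A ++ c ∷ B) (suc (len A)) (len B) (AfterAll (A ++ c ∷ B) c) (NotAfterAll (A ++ c ∷ B) c)
afterAll-delimits A c B avoid = record
  { In⇒inside     = In⇒inside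
  ; inside⇒In     = inside⇒In
  ; inside⇒¬Out   = λ { k _ (j , _ , e , ¬j<) → no-c-in-B j (≤-trans (m≤m+n off k) (≮⇒≥ ¬j<)) e }
  ; inside-or-Out = inside-or-Out
  }
  where
  w = A ++ c ∷ B
  off = suc (len A)
  c-at : letterAt w (len A) ≡ just c
  c-at = letterAt-middle A c B
  A<w : len A < len w
  A<w = letterAt-bound w (len A) c-at

  inside : ∀ j → off ≤ j → j < len w → Inside off (len B) j
  inside j off≤j j<w =
    j ∸ off , sym j≡ , +-cancelˡ-< off _ _ (subst₂ _<_ (sym j≡) (len-middle A c B) j<w)
    where j≡ = m+[n∸m]≡n off≤j

  no-c-in-B : ∀ j → off ≤ j → ¬ letterAt w j ≡ just c
  no-c-in-B j off≤j e =
    avoid (j ∸ off) (trans (sym (letterAt-after A c B (j ∸ off)))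
                           (subst (λ i → letterAt w i ≡ just c) (sym (m+[n∸m]≡n off≤j)) e))

  In⇒inside : ∀ i → i < len w → AfterAll w c i → Inside off (len B) i
  In⇒inside i i<w p with p (len A) A<w
  ... | inj₁ not-c = ⊥-elim (not-c c-at)
  ... | inj₂ A<i   = inside i A<i i<w

  inside⇒In : ∀ k → k < len B → AfterAll w c (off + k)
  inside⇒In k _ j _ with j <? off + k
  ... | yes j< = inj₂ j<
  ... | no ¬j< = inj₁ (no-c-in-B j (≤-trans (m≤m+n off k) (≮⇒≥ ¬j<)))

  inside-or-Out : ∀ i → i < len w → Inside off (len B) i ⊎ NotAfterAll w c i
  inside-or-Out i i<w with len A <? i
  ... | yes A<i = inj₁ (inside i A<i i<w)
  ... | no ¬A<i = inj₂ (len A , A<w , c-at , ¬A<i)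

module _ {m : ℕ} (a : Fin m) where

  before-first : ∀ A B φ → Sentence φ → Avoids (toℕ a) A → StartsWith (toℕ a) B →
    ((A ++ B) ⊨ relBefore a φ) ⇔ (A ⊨ φ)
  before-first A .(toℕ a ∷ B) φ closed avoid (B , refl) =
    Transfer.transfer (A ++ toℕ a ∷ B) A 0
      (letterAt-++ˡ A _)
      (<⇒≤ (letterAt-bound _ (len A) (letterAt-middle A (toℕ a) B)))
      (beforeAll-expresses a _) (notBeforeAll-expresses a _)
      (beforeAll-delimits A (toℕ a) B avoid) φ closed

  after-last : ∀ A B φ → Sentence φ → EndsWith (toℕ a) A → Avoids (toℕ a) B →
    ((A ++ B) ⊨ relAfter a φ) ⇔ (B ⊨ φ)
  after-last .(A ∷ʳ toℕ a) B φ closed (A , refl) avoid =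
    subst (λ w → (w ⊨ relAfter a φ) ⇔ (B ⊨ φ)) (sym (∷ʳ-++ A (toℕ a) B))
      (Transfer.transfer (A ++ toℕ a ∷ B) B (suc (len A))
        (λ k _ → letterAt-after A (toℕ a) B k)
        (≤-reflexive (sym (len-middle A (toℕ a) B)))
        (afterAll-expresses a _) (notAfterAll-expresses a _)
        (afterAll-delimits A (toℕ a) B avoid) φ closed)

Separating : ∀ {m} → Fm m → (ℕ → List ℕ) → (ℕ → List ℕ) → Set
Separating φ f g = ∀ n → 1 ≤ n → (f n ⊨ φ) × ¬ (g n ⊨ φ)

append-step : ∀ {m c} (a : Fin m) → toℕ a ≡ c → {φ : Fm m} {f g : ℕ → List ℕ} → Sentence φ →
  (∀ n → Avoids c (f n)) → (∀ n → Avoids c (g n)) →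
  (r : ℕ → List ℕ) → (∀ n → 1 ≤ n → StartsWith c (r n)) →
  Separating φ f g → Separating (relBefore a φ) (λ n → f n ++ r n) (λ n → g n ++ r n)
append-step a refl {φ} {f} {g} closed f-avoids g-avoids r starts sep n n≥1 =
  from (before-first a (f n) (r n) φ closed (f-avoids n) (starts n n≥1)) (proj₁ (sep n n≥1)) ,
  proj₂ (sep n n≥1) ∘ to (before-first a (g n) (r n) φ closed (g-avoids n) (starts n n≥1))

prepend-step : ∀ {m c} (a : Fin m) → toℕ a ≡ c → {φ : Fm m} {f g : ℕ → List ℕ} → Sentence φ →
  (∀ n → Avoids c (f n)) → (∀ n → Avoids c (g n)) →
  (p : ℕ → List ℕ) → (∀ n → 1 ≤ n → EndsWith c (p n)) →
  Separating φ f g → Separating (relAfter a φ) (λ n → p n ++ f n) (λ n → p n ++ g n)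
prepend-step a refl {φ} {f} {g} closed f-avoids g-avoids p ends sep n n≥1 =
  from (after-last a (p n) (f n) φ closed (ends n n≥1) (f-avoids n)) (proj₁ (sep n n≥1)) ,
  proj₂ (sep n n≥1) ∘ to (after-last a (p n) (g n) φ closed (ends n n≥1) (g-avoids n))

separating-if : ∀ {m} b {φ ψ : Fm m} {f f′ g g′ : ℕ → List ℕ} →
  Separating φ f g → Separating ψ f′ g′ →
  Separating (if b then φ else ψ) (λ n → if b then f n else f′ n) (λ n → if b then g n else g′ n)
separating-if true  sep _ = sep
separating-if false _ sep = sep

if-elim : ∀ {ℓ} {A : Set} (P : A → Set ℓ) b {x y : A} → P x → P y → P (if b then x else y)
if-elim P true  px _  = px
if-elim P false _  py = py

rep-snoc : ∀ n (w : List ℕ) → rep (suc n) w ≡ rep n w ++ w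
rep-snoc zero    w = ++-identityʳ w
rep-snoc (suc n) w = trans (cong (w ++_) (rep-snoc n w)) (sym (++-assoc w (rep n w) w))

rep-up-ends : ∀ t n → 1 ≤ n → EndsWith t (rep n (up t))
rep-up-ends t (suc n) _ = rep n (up t) ++ upTo t , (begin
  rep (suc n) (up t)             ≡⟨ rep-snoc n (up t) ⟩
  rep n (up t) ++ up t           ≡⟨ cong (rep n (up t) ++_) (sym (upTo-∷ʳ t)) ⟩
  rep n (up t) ++ upTo t ∷ʳ t    ≡⟨ sym (++-assoc (rep n (up t)) (upTo t) (t ∷ [])) ⟩
  (rep n (up t) ++ upTo t) ∷ʳ t  ∎)
  where open ≡-Reasoning

rep-down-starts : ∀ t n → 1 ≤ n → StartsWith t (rep n (down t))
rep-down-starts t (suc n) _ =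
  downFrom t ++ rep n (down t) , cong (_++ rep n (down t)) (reverse-upTo (suc t))

pairs-start : ∀ n → 1 ≤ n → StartsWith 1 (rep (2 * n) (1 ∷ 0 ∷ []))
pairs-start (suc n) _ = _ , refl

letters-rep : ∀ {P : ℕ → Set} {w} → All P w → ∀ n → All P (rep n w)
letters-rep _  zero    = []
letters-rep ws (suc n) = ++⁺ ws (letters-rep ws n)

letters-down : ∀ t → All (_< suc t) (down t)
letters-down t = subst (All (_< suc t)) (sym (reverse-upTo (suc t))) (applyDownFrom⁺₁ id (suc t) id)

letters-step : ∀ b t n {w} → All (_< t) w →
  All (_< suc t) (if b then rep n (up t) ++ w else w ++ rep n (down t))
letters-step true  t n ws = ++⁺ (letters-rep (all-upTo (suc t)) n) (All.map m<n⇒m<1+n ws)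
letters-step false t n ws = ++⁺ (All.map m<n⇒m<1+n ws) (letters-rep (letters-down t) n)

letters-u : ∀ j n → All (_< j) (u j n)
letters-u zero                n = []
letters-u (suc zero)          n = s≤s z≤n ∷ []
letters-u (suc (suc zero))    n = s≤s z≤n ∷ letters-rep (s≤s (s≤s z≤n) ∷ s≤s z≤n ∷ []) (2 * n)
letters-u (suc (suc (suc k))) n = letters-step (isEven k) (suc (suc k)) n (letters-u (suc (suc k)) n)

letters-v : ∀ j n → All (_< j) (v j n)
letters-v zero                n = []
letters-v (suc zero)          n = []
letters-v (suc (suc zero))    n = letters-rep (s≤s (s≤s z≤n) ∷ s≤s z≤n ∷ []) (2 * n)
letters-v (suc (suc (suc k))) n = letters-step (isEven k) (suc (suc k)) n (letters-v (suc (suc k)) n)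

module Construction (M : ℕ) where

  letter : ℕ → Fin (suc M)
  letter k = k mod suc M

  toℕ-letter : ∀ {k} → k ≤ M → toℕ (letter k) ≡ k
  toℕ-letter k≤M = trans (toℕ-fromℕ< _) (m<n⇒m%n≡m (s≤s k≤M))

  -- φ_j follows the definition of u_j: relativise after the last a_{j-1}
  -- when u_j prepends a block, before the first a_{j-1} when it appends one.
  phi : ℕ → Fm (suc M)
  phi zero                = tt
  phi (suc zero)          = ex vx (Q (letter 0) vx)
  phi (suc (suc zero))    = relBefore (letter 1) (phi 1)
  phi (suc (suc (suc k))) =
    if isEven k then relAfter (letter (suc (suc k))) (phi (suc (suc k)))
    else relBefore (letter (suc (suc k))) (phi (suc (suc k)))

  phi-sentence : ∀ j → Sentence (phi j)
  phi-sentence zero z ()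
  phi-sentence (suc zero) vx (fex x≢x _) = x≢x refl
  phi-sentence (suc zero) vy (fex _ ())
  phi-sentence (suc (suc zero)) = relBefore-sentence (letter 1) (phi 1) (phi-sentence 1)
  phi-sentence (suc t@(suc (suc k))) = if-elim Sentence (isEven k)
    (relAfter-sentence (letter t) (phi t) (phi-sentence t))
    (relBefore-sentence (letter t) (phi t) (phi-sentence t))

  phi-blocks : ∀ j → blocks (phi j) ≤ j
  phi-blocks zero             = z≤n
  phi-blocks (suc zero)       = ≤-refl
  phi-blocks (suc (suc zero)) = ≤-trans (relBefore-blocks (letter 1) (phi 1)) (s≤s (phi-blocks 1))
  phi-blocks (suc t@(suc (suc k))) = if-elim (λ φ → blocks φ ≤ suc t) (isEven k)
    (≤-trans (relAfter-blocks (letter t) (phi t)) (s≤s (phi-blocks t)))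
    (≤-trans (relBefore-blocks (letter t) (phi t)) (s≤s (phi-blocks t)))

  phi-separates : ∀ j → 1 ≤ j → j ≤ suc M → Separating (phi j) (u j) (v j)
  phi-separates (suc zero) _ _ n _ =
    (0 , s≤s z≤n , cong just (sym (toℕ-letter z≤n))) , λ { (_ , () , _) }
  phi-separates (suc (suc zero)) _ (s≤s 1≤M) =
    append-step (letter 1) (toℕ-letter 1≤M) (phi-sentence 1)
      (λ n → below⇒avoids (letters-u 1 n)) (λ n → below⇒avoids (letters-v 1 n))
      (λ n → rep (2 * n) (1 ∷ 0 ∷ [])) pairs-start
      (phi-separates 1 (s≤s z≤n) (s≤s z≤n))
  phi-separates (suc t@(suc (suc k))) _ (s≤s t≤M) =
    step (phi-separates t (s≤s z≤n) (m≤n⇒m≤1+n t≤M))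
    where
    avoids-u : ∀ n → Avoids t (u t n)
    avoids-u n = below⇒avoids (letters-u t n)
    avoids-v : ∀ n → Avoids t (v t n)
    avoids-v n = below⇒avoids (letters-v t n)
    step : Separating (phi t) (u t) (v t) → Separating (phi (suc t)) (u (suc t)) (v (suc t))
    step sep = separating-if (isEven k)
      (prepend-step (letter t) (toℕ-letter t≤M) (phi-sentence t) avoids-u avoids-v
        (λ n → rep n (up t)) (rep-up-ends t) sep)
      (append-step (letter t) (toℕ-letter t≤M) (phi-sentence t) avoids-u avoids-v
        (λ n → rep n (down t)) (rep-down-starts t) sep)

-- φ_m is a sentence with at most m blocks, so it lies in FO²_{m,n} for any
-- n ≥ max(m, qd φ_m); we take n = qd φ_m + m.
lemma4p9 : (m : ℕ) → 1 ≤ m →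
    Σ (Fm m) (λ φ → Sentence φ × InFO2k m φ × Separates φ (u m) (v m))
lemma4p9 zero ()
lemma4p9 (suc M) _ =
  phi (suc M) ,
  phi-sentence (suc M) ,
  (qd (phi (suc M)) + suc M , m≤n+m (suc M) _ , m≤m+n _ _ , phi-blocks (suc M)) ,
  inj₁ (proj₁ ∘₂ separates , proj₂ ∘₂ separates)
  where
  open Construction M
  separates : Separating (phi (suc M)) (u (suc M)) (v (suc M))
  separates = phi-separates (suc M) (s≤s z≤n) ≤-refl
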